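{- Let $n\ge 2$. For each $k\in\{1,\ldots,n-1\}$, the number of $\alpha\in\{0,\ldots,n!-2\}$ with $e_n(\alpha)=k$ equals $(n-k)\,(n-k)!$. Moreover \[ \sum_{\alpha=0}^{n!-2}e_n(\alpha)=1!+2!+\cdots+n!-n. \]
   Context: Let $\varpi_{n,0}=1$ and $\varpi_{n,i}=n(n-1)\cdots(n-i+1)$ for $1\le i\le n-2$. Every integer $\alpha\in\{0,\ldots,n!-1\}$ is uniquely $\alpha=\sum_{i=0}^{n-2}\alpha_i\varpi_{n,i}$ with digits $\alpha_i\in\{0,\ldots,n-i-1\}$. For $\alpha\in\{0,\ldots,n!-2\}$, let $k$ be the largest integer in $\{0,\ldots,n-2\}$ such that $\alpha_i=n-i-1$ for all $i=0,\ldots,k-1$, and define $e_n(\alpha)=k+1\in\{1,\ldots,n-1\}$. (Interpretation: for the permutations $p_0,\ldots,p_{n!-1}$ of $x_1,\ldots,x_n$ ordered by generation by cyclic shift, $e_n(\alpha)$ is the number of symbols erased on the left of $p_\alpha$ so that its last symbols match the first symbols of $p_{\alpha+1}$.) -}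

module Defs where

open import Data.Nat.Base
open import Data.Bool.Base using (Bool; true; false; _∧_; if_then_else_)
open import Data.List.Base using (List; applyUpTo)
open import Data.Bool.ListAction using (and)

ϖ : ℕ → ℕ → ℕ
ϖ n zero    = 1
ϖ n (suc i) = ϖ n i * (n ∸ i)

-- total division / modulo (only ever used with non-zero divisors below)
div' : ℕ → ℕ → ℕ
div' a zero    = 0
div' a (suc d) = a / suc d

mod' : ℕ → ℕ → ℕ
mod' a zero    = a
mod' a (suc d) = a % suc d

-- the digit α_i of α in the representation α = Σ_{i=0}^{n-2} α_i ϖ_{n,i},
-- α_i ∈ {0,…,n-i-1}
digit : ℕ → ℕ → ℕ → ℕ
digit n α i = mod' (div' α (ϖ n i)) (n ∸ i)

maxPrefix : ℕ → ℕ → ℕ → Bool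
maxPrefix n α k = and (applyUpTo (λ i → digit n α i ≡ᵇ (n ∸ i ∸ 1)) k)

largest : ℕ → ℕ → ℕ → ℕ
largest n α zero    = zero
largest n α (suc k) = if maxPrefix n α (suc k) then suc k else largest n α k

e : ℕ → ℕ → ℕ
e n α = suc (largest n α (n ∸ 2))

module Submission where

open import Defs
open import Data.Bool.Base using (true; false; _∧_; if_then_else_)
open import Data.Bool.ListAction using (and)
open import Data.Bool.Properties using (if-float)
open import Data.List.Base using ([]; _∷_; length; filter; map; upTo; applyUpTo)
open import Data.List.Properties using (map-upTo)
open import Data.Nat.Base using (ℕ; zero; suc; _+_; _*_; _∸_; _!; _/_; _%_; _≡ᵇ_; _≤_; _<_; z≤n; s≤s)
open import Data.Nat.DivMod
  using (m/n/o≡m/[n*o]; n/1≡n; [m+kn]%n≡m%n; m<n⇒m%n≡m; +-distrib-/-∣ʳ; m<n⇒m/n≡0; m*n/n≡m)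
open import Data.Nat.Divisibility using (divides-refl)
open import Data.Nat.ListAction using (sum)
open import Data.Nat.Properties
  using (_≟_; +-comm; +-assoc; +-identityʳ; +-suc; +-cancelʳ-≡; m+n∸n≡m; *-comm; *-assoc;
         *-identityˡ; *-identityʳ; *-zeroʳ; ≤-refl; m<n⇒m<1+n; 1≤n!)
open import Data.Nat.Tactic.RingSolver using (solve-∀)
open import Data.Product.Base using (_×_; _,_)
open import Function.Base using (_∘_; id)
open import Level using (0ℓ)
open import Relation.Binary.PropositionalEquality
  using (_≡_; refl; sym; trans; cong; cong₂; module ≡-Reasoning)
open import Relation.Nullary using (does)
open import Relation.Unary using (Pred; Decidable)

open ≡-Reasoning

-- Write α = β (m+1) + d with d < m+1.  The digits of α for n = m+1 are d followed
-- by the digits of β for n = m, so for m ≥ 2, e_{m+1}(α) = 1 + e_m(β) if d = m and 1 otherwise.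
-- Hence the sum of g(e_{m+1}(α)) over all (m+1)! values of α splits into m·m!·g(1)
-- plus the same sum for m with g shifted by one.  Unwinding this recursion gives the
-- distribution of e_n, with the extra value e_n(n!-1) = n-1 accounting for the
-- excluded last permutation.

∑< : ℕ → (ℕ → ℕ) → ℕ
∑< zero    f = 0
∑< (suc k) f = ∑< k f + f k

syntax ∑< k (λ i → x) = ∑[ i < k ] x

∑-cong : ∀ k {f g : ℕ → ℕ} → (∀ i → i < k → f i ≡ g i) → ∑< k f ≡ ∑< k g
∑-cong zero    f≡g = refl
∑-cong (suc k) f≡g = cong₂ _+_ (∑-cong k (λ i i<k → f≡g i (m<n⇒m<1+n i<k))) (f≡g k ≤-refl)

∑-const : ∀ k c → ∑[ _ < k ] c ≡ k * c
∑-const zero    c = refl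
∑-const (suc k) c = trans (cong (_+ c) (∑-const k c)) (+-comm (k * c) c)

∑-distrib-+ : ∀ k f g → ∑[ i < k ] (f i + g i) ≡ ∑< k f + ∑< k g
∑-distrib-+ zero    f g = refl
∑-distrib-+ (suc k) f g =
  trans (cong (_+ (f k + g k)) (∑-distrib-+ k f g)) (interchange (∑< k f) (∑< k g) (f k) (g k))
  where
  interchange : ∀ a b c d → (a + b) + (c + d) ≡ (a + c) + (b + d)
  interchange = solve-∀

∑-+ : ∀ a b f → ∑< (b + a) f ≡ ∑< a f + ∑[ i < b ] f (a + i)
∑-+ a zero    f = sym (+-identityʳ _)
∑-+ a (suc b) f = trans (cong₂ _+_ (∑-+ a b f) (cong f (+-comm b a))) (+-assoc (∑< a f) _ _)

∑-* : ∀ M n f → ∑< (M * n) f ≡ ∑[ β < M ] ∑[ d < n ] f (β * n + d)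
∑-* zero    n f = refl
∑-* (suc M) n f = trans (∑-+ (M * n) n f) (cong (_+ ∑[ d < n ] f (M * n + d)) (∑-* M n f))

∑-suc : ∀ k f → ∑[ i < k ] suc (f i) ≡ k + ∑< k f
∑-suc zero    f = refl
∑-suc (suc k) f = trans (cong (_+ suc (f k)) (∑-suc k f)) (rearrange k (∑< k f) (f k))
  where
  rearrange : ∀ a b c → a + b + suc c ≡ suc a + (b + c)
  rearrange = solve-∀

∑-init : ∀ {k} → 1 ≤ k → ∀ f → ∑< k f ≡ ∑< (k ∸ 1) f + f (k ∸ 1)
∑-init {suc k} _ f = refl

sum-upTo : ∀ k f → sum (map f (upTo k)) ≡ ∑< k f
sum-upTo k f = trans (cong sum (map-upTo f k)) (sum-applyUpTo k f)
  where
  ∑-head : ∀ k f → ∑< (suc k) f ≡ f 0 + ∑[ i < k ] f (suc i)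
  ∑-head zero    f = +-comm 0 (f 0)
  ∑-head (suc k) f = trans (cong (_+ f (suc k)) (∑-head k f)) (+-assoc (f 0) _ _)

  sum-applyUpTo : ∀ k f → sum (applyUpTo f k) ≡ ∑< k f
  sum-applyUpTo zero    f = refl
  sum-applyUpTo (suc k) f =
    trans (cong (f 0 +_) (sum-applyUpTo k (f ∘ suc))) (sym (∑-head k f))

length-filter≡sum-indicator : ∀ {P : Pred ℕ 0ℓ} (P? : Decidable P) xs →
  length (filter P? xs) ≡ sum (map (λ x → if does (P? x) then 1 else 0) xs)
length-filter≡sum-indicator P? []       = refl
length-filter≡sum-indicator P? (x ∷ xs) with does (P? x)
... | true  = cong suc (length-filter≡sum-indicator P? xs)
... | false = length-filter≡sum-indicator P? xs

ϖ-suc : ∀ m i → ϖ (suc m) (suc i) ≡ suc m * ϖ m i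
ϖ-suc m zero    = trans (*-identityˡ (suc m)) (sym (*-identityʳ (suc m)))
ϖ-suc m (suc i) = trans (cong (_* (m ∸ i)) (ϖ-suc m i)) (*-assoc (suc m) (ϖ m i) (m ∸ i))

digit-suc : ∀ m α i → digit (suc m) α (suc i) ≡ digit m (α / suc m) i
digit-suc m α i = cong (λ x → mod' x (m ∸ i)) (trans (cong (div' α) (ϖ-suc m i)) (div'-* (ϖ m i)))
  where
  div'-* : ∀ p → div' α (suc m * p) ≡ div' (α / suc m) p
  div'-* zero    rewrite *-zeroʳ m = refl
  div'-* (suc p) = sym (m/n/o≡m/[n*o] α (suc m) (suc p))

applyUpTo-cong : ∀ {A : Set} k {f g : ℕ → A} → (∀ i → f i ≡ g i) → applyUpTo f k ≡ applyUpTo g k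
applyUpTo-cong zero    f≡g = refl
applyUpTo-cong (suc k) f≡g = cong₂ _∷_ (f≡g 0) (applyUpTo-cong k (f≡g ∘ suc))

maxPrefix-suc : ∀ m α k →
  maxPrefix (suc m) α (suc k) ≡ (α % suc m ≡ᵇ m) ∧ maxPrefix m (α / suc m) k
maxPrefix-suc m α k = cong and (cong₂ _∷_
  (cong (λ x → x % suc m ≡ᵇ m) (n/1≡n α))
  (applyUpTo-cong k (λ i → cong (_≡ᵇ (m ∸ i ∸ 1)) (digit-suc m α i))))

module _ {m d : ℕ} (β : ℕ) (d<1+m : d < suc m) where

  %-lastDigit : (β * suc m + d) % suc m ≡ d
  %-lastDigit = trans (cong (_% suc m) (+-comm (β * suc m) d))
    (trans ([m+kn]%n≡m%n d β (suc m)) (m<n⇒m%n≡m d<1+m))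

  /-lastDigit : (β * suc m + d) / suc m ≡ β
  /-lastDigit = trans (cong (_/ suc m) (+-comm (β * suc m) d))
    (trans (+-distrib-/-∣ʳ d (divides-refl β)) (cong₂ _+_ (m<n⇒m/n≡0 d<1+m) (m*n/n≡m β (suc m))))

  maxPrefix-lastDigit : ∀ k →
    maxPrefix (suc m) (β * suc m + d) (suc k) ≡ (d ≡ᵇ m) ∧ maxPrefix m β k
  maxPrefix-lastDigit k = trans (maxPrefix-suc m (β * suc m + d) k)
    (cong₂ (λ r q → (r ≡ᵇ m) ∧ maxPrefix m q k) %-lastDigit /-lastDigit)

≡ᵇ-refl : ∀ m → (m ≡ᵇ m) ≡ true
≡ᵇ-refl zero    = refl
≡ᵇ-refl (suc m) = ≡ᵇ-refl m

<⇒≡ᵇ-false : ∀ {d m} → d < m → (d ≡ᵇ m) ≡ false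
<⇒≡ᵇ-false {zero}  {suc m} _         = refl
<⇒≡ᵇ-false {suc d} {suc m} (s≤s d<m) = <⇒≡ᵇ-false d<m

module _ {m : ℕ} (β : ℕ) where

  maxPrefix-maxDigit : ∀ k → maxPrefix (suc m) (β * suc m + m) (suc k) ≡ maxPrefix m β k
  maxPrefix-maxDigit k =
    trans (maxPrefix-lastDigit β ≤-refl k) (cong (_∧ maxPrefix m β k) (≡ᵇ-refl m))

  largest-maxDigit : ∀ k → largest (suc m) (β * suc m + m) (suc k) ≡ suc (largest m β k)
  largest-maxDigit zero    = cong (λ b → if b then 1 else 0) (maxPrefix-maxDigit 0)
  largest-maxDigit (suc k) = trans
    (cong₂ (λ b x → if b then suc (suc k) else x) (maxPrefix-maxDigit (suc k)) (largest-maxDigit k))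
    (sym (if-float suc (maxPrefix m β (suc k))))

  module _ {d : ℕ} (d<m : d < m) where

    maxPrefix-smallDigit : ∀ k → maxPrefix (suc m) (β * suc m + d) (suc k) ≡ false
    maxPrefix-smallDigit k = trans (maxPrefix-lastDigit β (m<n⇒m<1+n d<m) k)
      (cong (_∧ maxPrefix m β k) (<⇒≡ᵇ-false d<m))

    largest-smallDigit : ∀ k → largest (suc m) (β * suc m + d) k ≡ 0
    largest-smallDigit zero    = refl
    largest-smallDigit (suc k) = trans
      (cong (λ b → if b then suc k else largest (suc m) (β * suc m + d) k) (maxPrefix-smallDigit k))
      (largest-smallDigit k)

e-maxDigit : ∀ {m} → 2 ≤ m → ∀ β → e (suc m) (β * suc m + m) ≡ suc (e m β)
e-maxDigit {suc (suc j)} (s≤s (s≤s z≤n)) β = cong suc (largest-maxDigit β j)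

e-smallDigit : ∀ {m d} β → d < m → e (suc m) (β * suc m + d) ≡ 1
e-smallDigit {m} β d<m = cong suc (largest-smallDigit β d<m (suc m ∸ 2))

[1+m]*x∸1≡[x∸1]*[1+m]+m : ∀ m x → 1 ≤ x → suc m * x ∸ 1 ≡ (x ∸ 1) * suc m + m
[1+m]*x∸1≡[x∸1]*[1+m]+m m (suc x) _ = rearrange x m
  where
  rearrange : ∀ x m → x + m * suc x ≡ x * suc m + m
  rearrange = solve-∀

e-lastPermutation : ∀ j → e (2 + j) ((2 + j) ! ∸ 1) ≡ suc j
e-lastPermutation zero    = refl
e-lastPermutation (suc j) =
  trans (cong (e (suc m)) ([1+m]*x∸1≡[x∸1]*[1+m]+m m (m !) (1≤n! m)))
    (trans (e-maxDigit {m} (s≤s (s≤s z≤n)) (m ! ∸ 1)) (cong suc (e-lastPermutation j)))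
  where
  m = 2 + j

∑e : ℕ → (ℕ → ℕ) → ℕ
∑e n g = ∑[ α < n ! ] g (e n α)

∑e-suc : ∀ {m} → 2 ≤ m → ∀ g → ∑e (suc m) g ≡ m * m ! * g 1 + ∑e m (g ∘ suc)
∑e-suc {m} 2≤m g = begin
    ∑< (suc m * m !) (g ∘ e (suc m))
  ≡⟨ cong (λ x → ∑< x (g ∘ e (suc m))) (*-comm (suc m) (m !)) ⟩
    ∑< (m ! * suc m) (g ∘ e (suc m))
  ≡⟨ ∑-* (m !) (suc m) (g ∘ e (suc m)) ⟩
    ∑[ β < m ! ] ∑[ d < suc m ] g (e (suc m) (β * suc m + d))
  ≡⟨ ∑-cong (m !) (λ β _ → ∑-digits β) ⟩
    ∑[ β < m ! ] (m * g 1 + g (suc (e m β)))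
  ≡⟨ ∑-distrib-+ (m !) (λ _ → m * g 1) (g ∘ suc ∘ e m) ⟩
    ∑[ _ < m ! ] (m * g 1) + ∑e m (g ∘ suc)
  ≡⟨ cong (_+ ∑e m (g ∘ suc)) (∑-const (m !) (m * g 1)) ⟩
    m ! * (m * g 1) + ∑e m (g ∘ suc)
  ≡⟨ cong (_+ ∑e m (g ∘ suc))
       (trans (sym (*-assoc (m !) m (g 1))) (cong (_* g 1) (*-comm (m !) m))) ⟩
    m * m ! * g 1 + ∑e m (g ∘ suc)
  ∎
  where
  ∑-digits : ∀ β → ∑[ d < suc m ] g (e (suc m) (β * suc m + d)) ≡ m * g 1 + g (suc (e m β))
  ∑-digits β = cong₂ _+_
    (trans (∑-cong m (λ d d<m → cong g (e-smallDigit β d<m))) (∑-const m (g 1)))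
    (cong g (e-maxDigit 2≤m β))

indicator : ℕ → ℕ → ℕ
indicator k a = if does (a ≟ k) then 1 else 0

∑e-indicator : ∀ j k → 1 ≤ k → k ≤ suc j →
  ∑e (2 + j) (indicator k) ≡ (2 + j ∸ k) * (2 + j ∸ k) ! + indicator k (suc j)
∑e-indicator zero    1 _ _ = refl
∑e-indicator zero    (suc (suc k)) _ (s≤s ())
-- e never vanishes, so indicator 1 ∘ suc is identically 0 on its values.
∑e-indicator (suc j) 1 _ _ = begin
    ∑e (suc m) (indicator 1)
  ≡⟨ ∑e-suc {m} (s≤s (s≤s z≤n)) (indicator 1) ⟩
    m * m ! * 1 + ∑e m (indicator 1 ∘ suc)
  ≡⟨ cong₂ _+_ (*-identityʳ (m * m !)) (trans (∑-const (m !) 0) (*-zeroʳ (m !))) ⟩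
    m * m ! + 0
  ∎
  where
  m = 2 + j
∑e-indicator (suc j) (suc (suc k)) _ (s≤s (s≤s k≤j)) = begin
    ∑e (suc m) (indicator (2 + k))
  ≡⟨ ∑e-suc {m} (s≤s (s≤s z≤n)) (indicator (2 + k)) ⟩
    m * m ! * 0 + ∑e m (indicator (suc k))
  ≡⟨ cong (_+ ∑e m (indicator (suc k))) (*-zeroʳ (m * m !)) ⟩
    ∑e m (indicator (suc k))
  ≡⟨ ∑e-indicator j (suc k) (s≤s z≤n) (s≤s k≤j) ⟩
    (m ∸ suc k) * (m ∸ suc k) ! + indicator (suc k) (suc j)
  ∎
  where
  m = 2 + j

∑e-id : ∀ j → suc (∑e (2 + j) id) ≡ ∑[ i < 2 + j ] (suc i !)
∑e-id zero    = refl
∑e-id (suc j) = begin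
    suc (∑e (suc m) id)
  ≡⟨ cong suc (∑e-suc {m} (s≤s (s≤s z≤n)) id) ⟩
    suc (m * m ! * 1 + ∑e m suc)
  ≡⟨ cong (λ x → suc (m * m ! * 1 + x)) (∑-suc (m !) (e m)) ⟩
    suc (m * m ! * 1 + (m ! + ∑e m id))
  ≡⟨ rearrange (m !) (∑e m id) m ⟩
    suc (∑e m id) + suc m !
  ≡⟨ cong (_+ suc m !) (∑e-id j) ⟩
    ∑[ i < suc m ] (suc i !)
  ∎
  where
  m = 2 + j
  rearrange : ∀ F A m → suc (m * F * 1 + (F + A)) ≡ suc A + (F + m * F)
  rearrange = solve-∀

∑e-init : ∀ j g → ∑e (2 + j) g ≡ sum (map (g ∘ e (2 + j)) (upTo ((2 + j) ! ∸ 1))) + g (suc j)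
∑e-init j g = begin
    ∑e n g
  ≡⟨ ∑-init (1≤n! n) (g ∘ e n) ⟩
    ∑< K (g ∘ e n) + g (e n K)
  ≡⟨ cong₂ _+_ (sym (sum-upTo K (g ∘ e n))) (cong g (e-lastPermutation j)) ⟩
    sum (map (g ∘ e n) (upTo K)) + g (suc j)
  ∎
  where
  n = 2 + j
  K = n ! ∸ 1

length-filter-e : ∀ j k → 1 ≤ k → k ≤ suc j →
  length (filter (λ α → e (2 + j) α ≟ k) (upTo ((2 + j) ! ∸ 1))) ≡ (2 + j ∸ k) * (2 + j ∸ k) !
length-filter-e j k 1≤k k≤1+j = +-cancelʳ-≡ (indicator k (suc j)) _ _ (begin
    length (filter (λ α → e n α ≟ k) (upTo K)) + indicator k (suc j)
  ≡⟨ cong (_+ indicator k (suc j)) (length-filter≡sum-indicator (λ α → e n α ≟ k) (upTo K)) ⟩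
    sum (map (indicator k ∘ e n) (upTo K)) + indicator k (suc j)
  ≡⟨ sym (∑e-init j (indicator k)) ⟩
    ∑e n (indicator k)
  ≡⟨ ∑e-indicator j k 1≤k k≤1+j ⟩
    (n ∸ k) * (n ∸ k) ! + indicator k (suc j)
  ∎)
  where
  n = 2 + j
  K = n ! ∸ 1

sum-e : ∀ j →
  sum (map (e (2 + j)) (upTo ((2 + j) ! ∸ 1))) + (2 + j) ≡ sum (applyUpTo (λ i → suc i !) (2 + j))
sum-e j = begin
    sum (map (e n) (upTo K)) + suc (suc j)
  ≡⟨ +-suc _ (suc j) ⟩
    suc (sum (map (e n) (upTo K)) + suc j)
  ≡⟨ cong suc (sym (∑e-init j id)) ⟩
    suc (∑e n id)
  ≡⟨ ∑e-id j ⟩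
    ∑[ i < n ] (suc i !)
  ≡⟨ sym (sum-upTo n (λ i → suc i !)) ⟩
    sum (map (λ i → suc i !) (upTo n))
  ≡⟨ cong sum (map-upTo (λ i → suc i !) n) ⟩
    sum (applyUpTo (λ i → suc i !) n)
  ∎
  where
  n = 2 + j
  K = n ! ∸ 1

proposition16 : (n : ℕ) → 2 ≤ n →
    ((k : ℕ) → 1 ≤ k → k ≤ n ∸ 1 →
      length (filter (λ α → e n α ≟ k) (upTo (n ! ∸ 1))) ≡ (n ∸ k) * (n ∸ k) !)
    × (sum (map (e n) (upTo (n ! ∸ 1))) ≡ sum (applyUpTo (λ i → suc i !) n) ∸ n)
proposition16 (suc (suc j)) (s≤s (s≤s z≤n)) =
  length-filter-e j ,
  trans (sym (m+n∸n≡m _ (2 + j))) (cong (_∸ (2 + j)) (sum-e j))
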